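{- Let $\ell\ge0$ and $n\ge1$. Then $2\cdot\mathrm{ehr}(\mathcal{O}(I_{\ell+1}\oplus(I_1+I_1)),n)$ equals the number of ways to place $\ell+2$ (indistinguishable) queens on distinct cells of an $(n+\ell+2)\times(n+\ell+2)$ chessboard, no two in a common row or column, such that the number of unordered pairs of queens lying on a common diagonal (line of slope $+1$ or $-1$) is exactly $\binom{\ell+2}{2}$, i.e. every pair attacks diagonally (equivalently, all queens lie on one diagonal).
   Context: For a finite poset $(P,\preceq)$ on $[p]$, the order polytope $\mathcal{O}(P)\subset\mathbb{R}^p$ is defined by $0\le x_i\le 1$ and $x_i\le x_j$ whenever $i\prec j$, and $\mathrm{ehr}(\mathcal{O}(P),n)=|n\mathcal{O}(P)\cap\mathbb{Z}^p|$ for $n\ge1$. $I_k$ is the $k$-element chain; $+$ is the direct sum (disjoint union, no relations across) and $\oplus$ the ordinal sum (disjoint union with every element of the first summand below every element of the second). -}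

module Defs where

open import Data.Nat using (ℕ; zero; suc; _+_; _*_; _≡ᵇ_; _<ᵇ_; _≤ᵇ_)
open import Data.Fin using (Fin; toℕ; splitAt)
open import Data.Bool using (Bool; true; false; _∧_; _∨_; not; if_then_else_)
open import Data.List using (List; []; _∷_; [_]; map; concatMap; allFin; cartesianProduct)
open import Data.Sum using (_⊎_; inj₁; inj₂)
open import Data.Product using (_×_; _,_)

allB : {A : Set} → (A → Bool) → List A → Bool
allB p []       = true
allB p (x ∷ xs) = p x ∧ allB p xs

-- Finite posets on Fin p, given by their (decidable, Bool-valued)
-- strict order relation  i ≺ j.

record FinPoset : Set where
  field
    size : ℕ
    _≺_  : Fin size → Fin size → Bool
open FinPoset public

I : ℕ → FinPoset
I k = record { size = k ; _≺_ = λ i j → toℕ i <ᵇ toℕ j }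

_+ₚ_ : FinPoset → FinPoset → FinPoset
P +ₚ Q = record { size = size P + size Q ; _≺_ = rel }
  where
  rel : Fin (size P + size Q) → Fin (size P + size Q) → Bool
  rel i j with splitAt (size P) i | splitAt (size P) j
  ... | inj₁ a | inj₁ b = _≺_ P a b
  ... | inj₂ a | inj₂ b = _≺_ Q a b
  ... | _      | _      = false

_⊕ₚ_ : FinPoset → FinPoset → FinPoset
P ⊕ₚ Q = record { size = size P + size Q ; _≺_ = rel }
  where
  rel : Fin (size P + size Q) → Fin (size P + size Q) → Bool
  rel i j with splitAt (size P) i | splitAt (size P) j
  ... | inj₁ a | inj₁ b = _≺_ P a b
  ... | inj₂ a | inj₂ b = _≺_ Q a b
  ... | inj₁ _ | inj₂ _ = true
  ... | inj₂ _ | inj₁ _ = false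

countB : {A : Set} → (A → Bool) → List A → ℕ
countB p []       = 0
countB p (x ∷ xs) = if p x then suc (countB p xs) else countB p xs

allFuns : {A : Set} → (m : ℕ) → List A → List (Fin m → A)
allFuns zero    xs = [ (λ ()) ]
allFuns (suc m) xs =
  concatMap (λ a → map (λ f → λ { Fin.zero → a ; (Fin.suc i) → f i }) (allFuns m xs)) xs

-- Ehrhart function of the order polytope:
-- ehr(O(P), n) = #{ x ∈ ℤ^p : 0 ≤ x_i ≤ n, x_i ≤ x_j whenever i ≺ j }.
-- Lattice points are enumerated as maps Fin p → Fin (n+1) (i.e. 0 ≤ x_i ≤ n).

inDilatedOrderPolytope : (P : FinPoset) (n : ℕ) → (Fin (size P) → Fin (suc n)) → Bool
inDilatedOrderPolytope P n x =
  allB (λ i → allB (λ j → not (_≺_ P i j) ∨ (toℕ (x i) ≤ᵇ toℕ (x j))) (allFin (size P))) (allFin (size P))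

ehr : FinPoset → ℕ → ℕ
ehr P n = countB (inDilatedOrderPolytope P n) (allFuns (size P) (allFin (suc n)))

-- A placement of indistinguishable queens on
-- distinct cells is a set of cells, i.e. a board B : Fin N → Fin N → Bool
-- (B r c = true iff cell (row r, column c) is occupied).

Cell : ℕ → Set
Cell N = Fin N × Fin N

cells : (N : ℕ) → List (Cell N)
cells N = cartesianProduct (allFin N) (allFin N)

cellIndex : {N : ℕ} → Cell N → ℕ
cellIndex {N} (r , c) = toℕ r * N + toℕ c

cellPairs : (N : ℕ) → List (Cell N × Cell N)
cellPairs N = concatMap (λ c → concatMap (λ d → if cellIndex c <ᵇ cellIndex d then [ (c , d) ] else []) (cells N)) (cells N)

sameRow sameCol sameDiag : {N : ℕ} → Cell N → Cell N → Bool
sameRow (r₁ , _) (r₂ , _) = toℕ r₁ ≡ᵇ toℕ r₂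
sameCol (_ , c₁) (_ , c₂) = toℕ c₁ ≡ᵇ toℕ c₂
sameDiag (r₁ , c₁) (r₂ , c₂) =
  ((toℕ r₁ + toℕ c₂) ≡ᵇ (toℕ r₂ + toℕ c₁)) ∨ ((toℕ r₁ + toℕ c₁) ≡ᵇ (toℕ r₂ + toℕ c₂))

Board : ℕ → Set
Board N = Fin N → Fin N → Bool

allBoards : (N : ℕ) → List (Board N)
allBoards N = allFuns N (allFuns N (true ∷ false ∷ []))

occ : {N : ℕ} → Board N → Cell N → Bool
occ B (r , c) = B r c

numQueens : {N : ℕ} → Board N → ℕ
numQueens {N} B = countB (occ B) (cells N)

nonAttackingRowsCols : {N : ℕ} → Board N → Bool
nonAttackingRowsCols {N} B =
  allB (λ { (c , d) → not (occ B c ∧ occ B d) ∨ (not (sameRow c d) ∧ not (sameCol c d)) }) (cellPairs N)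

diagonalPairs : {N : ℕ} → Board N → ℕ
diagonalPairs {N} B = countB (λ { (c , d) → occ B c ∧ occ B d ∧ sameDiag c d }) (cellPairs N)

queenPlacements : (N k D : ℕ) → ℕ
queenPlacements N k D =
  countB (λ B → (numQueens B ≡ᵇ k) ∧ nonAttackingRowsCols B ∧ (diagonalPairs B ≡ᵇ D)) (allBoards N)

module Submission where

-- Both sides equal 2 * (N C k + 2 * N C (k + 1)) for N = n + ℓ + 2 and k = ℓ + 2.
--
-- A lattice point of n·O(I (ℓ+1) ⊕ (I 1 + I 1)) is a chain x₀ ≤ … ≤ x_ℓ in [0, n] together with
-- two values above x_ℓ. Summing over the bottom value shortens the chain by one, and the
-- hockey-stick identity carries the count s² = s C 1 + 2 * s C 2 of the two top values along.
--
-- A cell lies on exactly one diagonal and one antidiagonal, and these two lines meet only in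
-- that cell. Hence if k ≥ 2 queens pairwise share a diagonal line, they all lie on the line
-- through two of them, and conversely queens on one line are in distinct rows and columns and
-- attack pairwise. Any set of c cells contains c C k subsets of size k, so the placements
-- number Σ (|L| C k) over all 2 (2N − 1) lines L; in each direction the lengths are 1, …, N
-- and 1, …, N − 1, and the hockey-stick identity evaluates the sum.

open import Defs
open import Data.Nat using (ℕ; _+_; _*_; _≤_)
open import Data.Nat.Combinatorics using (_C_)
open import Relation.Binary.PropositionalEquality using (_≡_)

open import Data.Nat using (zero; suc; _∸_; _<_; _≤ᵇ_; _<ᵇ_; _≡ᵇ_; z≤n; s≤s; s≤s⁻¹; z<s; s<s)
open import Data.Nat.Properties
open import Data.Nat.Combinatorics using (nC1≡n; k>n⇒nCk≡0; nCk+nC[k+1]≡[n+1]C[k+1])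
open import Data.Nat.Tactic.RingSolver using (solve-∀)
open import Data.Fin as Fin using (Fin; toℕ; opposite; inject₁; fromℕ; splitAt; combine; remQuot)
  renaming (zero to fz; suc to fs)
open import Data.Fin.Properties
  using (toℕ<n; toℕ-injective; toℕ-inject₁; toℕ-fromℕ; toℕ-↑ˡ; toℕ-↑ʳ; splitAt⁻¹-↑ˡ; splitAt⁻¹-↑ʳ;
         toℕ-combine; remQuot-combine; combine-monoˡ-<; opposite-prop)
open import Data.Fin.Permutation using (_⟨$⟩ʳ_) renaming (reverse to reversal)
open import Data.Bool using (Bool; true; false; _∧_; _∨_; not; if_then_else_; T)
open import Data.Bool.Properties using (T-∧; T-∨; T-≡; ∧-identityʳ; ∧-zeroʳ)
open import Data.List using (List; []; _∷_; [_]; _++_; map; concatMap; tabulate; allFin; cartesianProduct)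
open import Data.List.Relation.Unary.All as All using (All; []; _∷_)
import Data.List.Relation.Unary.All.Properties as All
open import Data.List.Relation.Unary.Any as Any using (Any; here)
open import Data.List.Relation.Unary.AllPairs as AllPairs using (AllPairs; []; _∷_)
import Data.List.Relation.Unary.AllPairs.Properties as AllPairs
open import Data.List.Membership.Propositional using (_∈_)
open import Data.List.Membership.Propositional.Properties
  using (∈-allFin; ∈-cartesianProduct⁺; ∈-cartesianProduct⁻; ∈-concatMap⁺; ∈-concatMap⁻)
open import Data.Product using (_×_; _,_; proj₁; proj₂; ∃-syntax)
open import Data.Product.Properties using (≡-dec)
open import Data.Empty using (⊥-elim)
open import Data.Sum as Sum using (_⊎_; inj₁; inj₂) renaming (map to ⊎-map)
open import Function using (_∘_; _$_; Equivalence)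
open import Relation.Binary.PropositionalEquality
  using (_≢_; refl; sym; trans; cong; cong₂; subst; subst₂; module ≡-Reasoning)
open import Relation.Binary.Definitions using (DecidableEquality; tri<; tri≈; tri>)
open import Relation.Nullary using (¬_; contradiction; yes; no)
open import Algebra.Properties.CommutativeMonoid.Sum +-0-commutativeMonoid
  using (sum; sum-cong-≗; sum-syntax; sum-init-last; sum-replicate-zero; ∑-distrib-+; ∑-permute)

private variable
  A X : Set

𝟙 : Bool → ℕ
𝟙 b = if b then 1 else 0

sumOf : (A → ℕ) → List A → ℕ
sumOf f []       = 0
sumOf f (x ∷ xs) = f x + sumOf f xs

sumOf-cong : {f g : A → ℕ} (xs : List A) → (∀ x → f x ≡ g x) → sumOf f xs ≡ sumOf g xs
sumOf-cong []       e = refl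
sumOf-cong (x ∷ xs) e = cong₂ _+_ (e x) (sumOf-cong xs e)

sumOf-congᴬ : {f g : A → ℕ} {xs : List A} → All (λ x → f x ≡ g x) xs → sumOf f xs ≡ sumOf g xs
sumOf-congᴬ []       = refl
sumOf-congᴬ (e ∷ es) = cong₂ _+_ e (sumOf-congᴬ es)

sumOf-zero : (xs : List A) → sumOf (λ _ → 0) xs ≡ 0
sumOf-zero []       = refl
sumOf-zero (x ∷ xs) = sumOf-zero xs

sumOf-+ : (f g : A → ℕ) (xs : List A) → sumOf (λ x → f x + g x) xs ≡ sumOf f xs + sumOf g xs
sumOf-+ f g []       = refl
sumOf-+ f g (x ∷ xs) = trans (cong (f x + g x +_) (sumOf-+ f g xs)) (interchange (f x) (g x) _ _)
  where
  interchange : ∀ a b c d → a + b + (c + d) ≡ a + c + (b + d)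
  interchange = solve-∀

sumOf-++ : (f : A → ℕ) (xs ys : List A) → sumOf f (xs ++ ys) ≡ sumOf f xs + sumOf f ys
sumOf-++ f []       ys = refl
sumOf-++ f (x ∷ xs) ys = trans (cong (f x +_) (sumOf-++ f xs ys)) (sym (+-assoc (f x) _ _))

sumOf-map : (f : X → ℕ) (g : A → X) (xs : List A) → sumOf f (map g xs) ≡ sumOf (f ∘ g) xs
sumOf-map f g []       = refl
sumOf-map f g (x ∷ xs) = cong (f (g x) +_) (sumOf-map f g xs)

sumOf-concatMap : (f : X → ℕ) (g : A → List X) (xs : List A) →
                  sumOf f (concatMap g xs) ≡ sumOf (sumOf f ∘ g) xs
sumOf-concatMap f g []       = refl
sumOf-concatMap f g (x ∷ xs) =
  trans (sumOf-++ f (g x) (concatMap g xs)) (cong (sumOf f (g x) +_) (sumOf-concatMap f g xs))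

sumOf-if-∧ : (p : Bool) (q : A → Bool) (f : A → ℕ) (xs : List A) →
             sumOf (λ x → if p ∧ q x then f x else 0) xs
               ≡ (if p then sumOf (λ x → if q x then f x else 0) xs else 0)
sumOf-if-∧ true  q f xs = refl
sumOf-if-∧ false q f xs = sumOf-zero xs

sumOf-if-const : (p : A → Bool) (c : ℕ) (xs : List A) →
                 sumOf (λ x → if p x then c else 0) xs ≡ sumOf (𝟙 ∘ p) xs * c
sumOf-if-const p c []       = refl
sumOf-if-const p c (x ∷ xs) with p x
... | true  = cong (c +_) (sumOf-if-const p c xs)
... | false = sumOf-if-const p c xs

countB≡sumOf : (p : A → Bool) (xs : List A) → countB p xs ≡ sumOf (𝟙 ∘ p) xs
countB≡sumOf p []       = refl
countB≡sumOf p (x ∷ xs) with p x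
... | true  = cong suc (countB≡sumOf p xs)
... | false = countB≡sumOf p xs

sumOf-tabulate : ∀ {n} (f : A → ℕ) (g : Fin n → A) → sumOf f (tabulate g) ≡ ∑[ i < n ] f (g i)
sumOf-tabulate {n = zero}  f g = refl
sumOf-tabulate {n = suc n} f g = cong (f (g fz) +_) (sumOf-tabulate f (g ∘ fs))

sumOf-allFin : ∀ n (f : Fin n → ℕ) → sumOf f (allFin n) ≡ ∑[ i < n ] f i
sumOf-allFin n f = sumOf-tabulate f (λ i → i)

sumOf-cartesianProduct : {B : Set} (f : A × B → ℕ) (xs : List A) (ys : List B) →
  sumOf f (cartesianProduct xs ys) ≡ sumOf (λ x → sumOf (λ y → f (x , y)) ys) xs
sumOf-cartesianProduct f []       ys = refl
sumOf-cartesianProduct f (x ∷ xs) ys = trans (sumOf-++ f (map (x ,_) ys) (cartesianProduct xs ys))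
  (cong₂ _+_ (sumOf-map f (x ,_) ys) (sumOf-cartesianProduct f xs ys))

-- The summand is given through head and tail, so that it computes on the pattern-matching
-- lambdas from which allFuns builds its functions.
sumOf-allFuns-suc : ∀ m (xs : List A) (G : A → (Fin m → A) → ℕ) →
  sumOf (λ f → G (f fz) (f ∘ fs)) (allFuns (suc m) xs) ≡ sumOf (λ x → sumOf (G x) (allFuns m xs)) xs
sumOf-allFuns-suc m xs G =
  trans (sumOf-concatMap _ _ xs) (sumOf-cong xs (λ x → sumOf-map _ _ (allFuns m xs)))

∑-cong : ∀ n {f g : Fin n → ℕ} → (∀ i → f i ≡ g i) → ∑[ i < n ] f i ≡ ∑[ i < n ] g i
∑-cong n {f} {g} = sum-cong-≗ {n} {f} {g}

sumOf-∑ : ∀ {n} (f : A → Fin n → ℕ) (xs : List A) →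
          sumOf (λ x → ∑[ i < n ] f x i) xs ≡ ∑[ i < n ] sumOf (λ x → f x i) xs
sumOf-∑ {n = n} f []       = sym (sum-replicate-zero n)
sumOf-∑         f (x ∷ xs) = trans (cong (sum (f x) +_) (sumOf-∑ f xs)) (sym (∑-distrib-+ (f x) _))

∑-split : ∀ m n (f : ℕ → ℕ) →
          ∑[ i < m + n ] f (toℕ i) ≡ ∑[ i < m ] f (toℕ i) + ∑[ j < n ] f (m + toℕ j)
∑-split zero    n f = refl
∑-split (suc m) n f = trans (cong (f 0 +_) (∑-split m n (f ∘ suc))) (sym (+-assoc (f 0) _ _))

∑-snoc : ∀ n (f : ℕ → ℕ) → ∑[ i < suc n ] f (toℕ i) ≡ ∑[ i < n ] f (toℕ i) + f n
∑-snoc n f = begin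
  ∑[ i < suc n ] f (toℕ i)                            ≡⟨ sum-init-last {n} (f ∘ toℕ) ⟩
  ∑[ i < n ] f (toℕ (inject₁ i)) + f (toℕ (fromℕ n))  ≡⟨ cong₂ _+_ (∑-cong n (cong f ∘ toℕ-inject₁))
                                                                   (cong f (toℕ-fromℕ n)) ⟩
  ∑[ i < n ] f (toℕ i) + f n                          ∎
  where open ≡-Reasoning

∑-reverse : ∀ n (f : ℕ → ℕ) → ∑[ i < n ] f (n ∸ toℕ i) ≡ ∑[ i < n ] f (suc (toℕ i))
∑-reverse n f = trans (∑-permute {n} {n} (λ i → f (n ∸ toℕ i)) (reversal {n})) (∑-cong n reflected)
  where
  reflected : ∀ i → f (n ∸ toℕ (reversal {n} ⟨$⟩ʳ i)) ≡ f (suc (toℕ i))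
  reflected i = cong f (trans (cong (n ∸_) (opposite-prop i)) (m∸[m∸n]≡n (toℕ<n i)))

T-ext : {a b : Bool} → (T a → T b) → (T b → T a) → a ≡ b
T-ext {false} {false} _ _ = refl
T-ext {false} {true}  _ g with () ← g _
T-ext {true}  {false} f _ with () ← f _
T-ext {true}  {true}  _ _ = refl

<ᵇ-true : ∀ {m n} → m < n → (m <ᵇ n) ≡ true
<ᵇ-true = Equivalence.to T-≡ ∘ <⇒<ᵇ

<ᵇ-false : ∀ {m n} → n ≤ m → (m <ᵇ n) ≡ false
<ᵇ-false {m} {n} n≤m with m <ᵇ n in eq
... | false = refl
... | true  = contradiction (<ᵇ⇒< m n (Equivalence.from T-≡ eq)) (≤⇒≯ n≤m)

suc≤ᵇsuc : ∀ m n → (suc m ≤ᵇ suc n) ≡ (m ≤ᵇ n)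
suc≤ᵇsuc zero    n = refl
suc≤ᵇsuc (suc m) n = refl

≤ᵇ≡<ᵇsuc : ∀ m n → (m ≤ᵇ n) ≡ (m <ᵇ suc n)
≤ᵇ≡<ᵇsuc zero    n = refl
≤ᵇ≡<ᵇsuc (suc m) n = refl

+-<ᵇ-cancelˡ : ∀ m a b → (m + a <ᵇ m + b) ≡ (a <ᵇ b)
+-<ᵇ-cancelˡ zero    a b = refl
+-<ᵇ-cancelˡ (suc m) a b = +-<ᵇ-cancelˡ m a b

T-not : ∀ {b} → ¬ T b → T (not b)
T-not {false} _  = _
T-not {true}  ¬t = ¬t _

T-not-∨⁻ : ∀ a {b} → T (not a ∨ b) → T a → T b
T-not-∨⁻ true t _ = t

T-not-∨⁺ : ∀ a {b} → (T a → T b) → T (not a ∨ b)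
T-not-∨⁺ true  f = f _
T-not-∨⁺ false f = _

allB⁻ : (p : A → Bool) (xs : List A) → T (allB p xs) → All (T ∘ p) xs
allB⁻ p []       _ = []
allB⁻ p (x ∷ xs) t = proj₁ pxs ∷ allB⁻ p xs (proj₂ pxs)
  where pxs = Equivalence.to (T-∧ {p x} {allB p xs}) t

allB⁺ : (p : A → Bool) {xs : List A} → All (T ∘ p) xs → T (allB p xs)
allB⁺ p []         = _
allB⁺ p (px ∷ pxs) = Equivalence.from T-∧ (px , allB⁺ p pxs)

𝟙-∧ : ∀ p q → 𝟙 (p ∧ q) ≡ (if p then 𝟙 q else 0)
𝟙-∧ true  q = refl
𝟙-∧ false q = refl

𝟙-¬T : ∀ {b} → ¬ T b → 𝟙 b ≡ 0
𝟙-¬T {false} _  = refl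
𝟙-¬T {true}  ¬t = contradiction _ ¬t

∑-𝟙-≡ᵇ : ∀ n t → ∑[ i < n ] 𝟙 (toℕ i ≡ᵇ t) ≡ 𝟙 (t <ᵇ n)
∑-𝟙-≡ᵇ zero    t       = refl
∑-𝟙-≡ᵇ (suc n) zero    = cong suc (sum-replicate-zero n)
∑-𝟙-≡ᵇ (suc n) (suc t) = ∑-𝟙-≡ᵇ n t

∑-𝟙-≤ᵇ : ∀ n m → ∑[ i < n ] 𝟙 (m ≤ᵇ toℕ i) ≡ n ∸ m
∑-𝟙-≤ᵇ zero    m       = sym (0∸n≡0 m)
∑-𝟙-≤ᵇ (suc n) zero    = cong suc (∑-𝟙-≤ᵇ n zero)
∑-𝟙-≤ᵇ (suc n) (suc m) = trans (∑-cong n (λ i → cong 𝟙 (suc≤ᵇsuc m (toℕ i)))) (∑-𝟙-≤ᵇ n m)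

∑-𝟙-<ᵇ : ∀ n m → m ≤ n → ∑[ i < n ] 𝟙 (toℕ i <ᵇ m) ≡ m
∑-𝟙-<ᵇ n       zero    _         = sum-replicate-zero n
∑-𝟙-<ᵇ (suc n) (suc m) (s≤s m≤n) = cong suc (∑-𝟙-<ᵇ n m m≤n)

∑-𝟙-+≡ᵇ : ∀ a n t → ∑[ c < n ] 𝟙 (a + toℕ c ≡ᵇ t) ≡ 𝟙 ((a ≤ᵇ t) ∧ (t <ᵇ a + n))
∑-𝟙-+≡ᵇ zero    n t       = ∑-𝟙-≡ᵇ n t
∑-𝟙-+≡ᵇ (suc a) n zero    = sum-replicate-zero n
∑-𝟙-+≡ᵇ (suc a) n (suc t) =
  trans (∑-𝟙-+≡ᵇ a n t) (cong (λ b → 𝟙 (b ∧ (t <ᵇ a + n))) (sym (suc≤ᵇsuc a t)))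

∑-lowerBound : ∀ M lo (H : ℕ → ℕ) →
  ∑[ v < M ] (if lo ≤ᵇ toℕ v then H (M ∸ toℕ v) else 0) ≡ ∑[ t < M ∸ lo ] H (suc (toℕ t))
∑-lowerBound M       zero     H = ∑-reverse M H
∑-lowerBound zero    (suc lo) H = refl
∑-lowerBound (suc M) (suc lo) H =
  trans (∑-cong M (λ v → cong (λ b → if b then H (M ∸ toℕ v) else 0) (suc≤ᵇsuc lo (toℕ v))))
        (∑-lowerBound M lo H)

countB-congᴬ : {p q : A → Bool} {xs : List A} → All (λ x → p x ≡ q x) xs → countB p xs ≡ countB q xs
countB-congᴬ {p = p} {q} {xs} e =
  trans (countB≡sumOf p xs) (trans (sumOf-congᴬ (All.map (cong 𝟙) e)) (sym (countB≡sumOf q xs)))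

module _ (p q : A → Bool) (q⇒p : ∀ x → T (q x) → T (p x)) where
  private
    q≢true : ∀ {x} → p x ≡ false → q x ≢ true
    q≢true {x} px qx = subst T px (q⇒p x (subst T (sym qx) _))

  countB-mono : ∀ xs → countB q xs ≤ countB p xs
  countB-mono []       = z≤n
  countB-mono (x ∷ xs) with q x in qx | p x in px
  ... | true  | true  = s≤s (countB-mono xs)
  ... | true  | false = ⊥-elim (q≢true px qx)
  ... | false | true  = m≤n⇒m≤1+n (countB-mono xs)
  ... | false | false = countB-mono xs

  countB-≡⇒All : ∀ xs → countB q xs ≡ countB p xs → All (λ x → T (p x) → T (q x)) xs
  countB-≡⇒All []       _ = []
  countB-≡⇒All (x ∷ xs) e with q x in qx | p x in px
  ... | true  | true  = (λ _ → subst T (sym qx) _) ∷ countB-≡⇒All xs (suc-injective e)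
  ... | true  | false = ⊥-elim (q≢true px qx)
  ... | false | true  = contradiction (subst (_≤ countB p xs) e (countB-mono xs)) 1+n≰n
  ... | false | false = (λ t → ⊥-elim (subst T px t)) ∷ countB-≡⇒All xs e

module _ (p : A → Bool) where
  pickOne : ∀ {P : A → Set} {xs} → All P xs → 1 ≤ countB p xs → ∃[ x ] T (p x) × P x
  pickOne {xs = x ∷ xs} (Px ∷ Pxs) c with p x in px
  ... | true  = x , subst T (sym px) _ , Px
  ... | false = pickOne Pxs c

  pickTwo : ∀ {R : A → A → Set} {xs} → AllPairs R xs → 2 ≤ countB p xs →
            ∃[ x ] ∃[ y ] T (p x) × T (p y) × R x y
  pickTwo {xs = x ∷ xs} (Rx ∷ Rxs) c with p x in px
  ... | true  = let y , py , Rxy = pickOne Rx (s≤s⁻¹ c) in x , y , subst T (sym px) _ , py , Rxy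
  ... | false = pickTwo Rxs c

  sumOf-increasingPairs : ∀ (key : A → ℕ) {xs} → AllPairs (λ x y → key x < key y) xs →
    sumOf (λ x → sumOf (λ y → if key x <ᵇ key y then 𝟙 (p x ∧ p y) else 0) xs) xs ≡ countB p xs C 2
  sumOf-increasingPairs key {[]}     []          = refl
  sumOf-increasingPairs key {h ∷ xs} (h< ∷ xs↑) = begin
      pair h h + sumOf (pair h) xs + sumOf (λ x → pair x h + sumOf (pair x) xs) xs
    ≡⟨ cong₂ (λ a b → a + sumOf (pair h) xs + b) (pairOff (≤-refl {key h}))
         (sumOf-congᴬ (All.map (λ {x} h<x → cong (_+ sumOf (pair x) xs) (pairOff (<⇒≤ h<x))) h<)) ⟩
      sumOf (pair h) xs + sumOf (λ x → sumOf (pair x) xs) xs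
    ≡⟨ cong₂ _+_ (sumOf-congᴬ (All.map pairOn h<)) (sumOf-increasingPairs key xs↑) ⟩
      sumOf (λ y → 𝟙 (p h ∧ p y)) xs + c C 2
    ≡⟨ cong (_+ c C 2) (trans (sumOf-if-∧ (p h) p (λ _ → 1) xs)
                              (cong (λ s → if p h then s else 0) (sym (countB≡sumOf p xs)))) ⟩
      (if p h then c else 0) + c C 2
    ≡⟨ consPairs (p h) ⟩
      countB p (h ∷ xs) C 2
    ∎
    where
    open ≡-Reasoning
    c = countB p xs
    pair : A → A → ℕ
    pair x y = if key x <ᵇ key y then 𝟙 (p x ∧ p y) else 0
    pairOff : ∀ {x y} → key y ≤ key x → pair x y ≡ 0
    pairOff {x} {y} y≤x = cong (λ b → if b then 𝟙 (p x ∧ p y) else 0) (<ᵇ-false y≤x)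
    pairOn : ∀ {x y} → key x < key y → pair x y ≡ 𝟙 (p x ∧ p y)
    pairOn {x} {y} x<y = cong (λ b → if b then 𝟙 (p x ∧ p y) else 0) (<ᵇ-true x<y)
    consPairs : ∀ b → (if b then c else 0) + c C 2 ≡ (if b then suc c else c) C 2
    consPairs true  = trans (cong (_+ c C 2) (sym (nC1≡n c))) (nCk+nC[k+1]≡[n+1]C[k+1] c 1)
    consPairs false = refl

-- Binomial sums

-- binomialSum c G = Σⱼ (c C j) * G j, the sum of G ∣S∣ over the subsets S of a c-element set.
binomialSum : ℕ → (ℕ → ℕ) → ℕ
binomialSum zero    G = G 0
binomialSum (suc c) G = binomialSum c G + binomialSum c (G ∘ suc)

binomialSum-zero : ∀ c → binomialSum c (λ _ → 0) ≡ 0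
binomialSum-zero zero    = refl
binomialSum-zero (suc c) = cong₂ _+_ (binomialSum-zero c) (binomialSum-zero c)

binomialSum-+ : ∀ a b G → binomialSum a (λ j → binomialSum b (G ∘ (j +_))) ≡ binomialSum (a + b) G
binomialSum-+ zero    b G = refl
binomialSum-+ (suc a) b G = cong₂ _+_ (binomialSum-+ a b G) (binomialSum-+ a b (G ∘ suc))

binomialSum-≡ᵇ : ∀ c k → binomialSum c (λ j → 𝟙 (j ≡ᵇ k)) ≡ c C k
binomialSum-≡ᵇ zero    zero    = refl
binomialSum-≡ᵇ zero    (suc k) = refl
binomialSum-≡ᵇ (suc c) zero    = cong₂ _+_ (binomialSum-≡ᵇ c zero) (binomialSum-zero c)
binomialSum-≡ᵇ (suc c) (suc k) = begin
  binomialSum c (λ j → 𝟙 (j ≡ᵇ suc k)) + binomialSum c (λ j → 𝟙 (j ≡ᵇ k))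
    ≡⟨ cong₂ _+_ (binomialSum-≡ᵇ c (suc k)) (binomialSum-≡ᵇ c k) ⟩
  c C suc k + c C k
    ≡⟨ +-comm (c C suc k) (c C k) ⟩
  c C k + c C suc k
    ≡⟨ nCk+nC[k+1]≡[n+1]C[k+1] c k ⟩
  suc c C suc k
    ∎
  where open ≡-Reasoning

∑-hockey : ∀ m k → ∑[ t < m ] (suc (toℕ t) C suc k) ≡ suc m C suc (suc k)
∑-hockey zero    k = refl
∑-hockey (suc m) k = begin
  ∑[ t < suc m ] (suc (toℕ t) C suc k)              ≡⟨ ∑-snoc m (λ t → suc t C suc k) ⟩
  ∑[ t < m ] (suc (toℕ t) C suc k) + suc m C suc k  ≡⟨ cong (_+ suc m C suc k) (∑-hockey m k) ⟩
  suc m C suc (suc k) + suc m C suc k               ≡⟨ +-comm (suc m C suc (suc k)) _ ⟩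
  suc m C suc k + suc m C suc (suc k)               ≡⟨ nCk+nC[k+1]≡[n+1]C[k+1] (suc m) (suc k) ⟩
  suc (suc m) C suc (suc k)                         ∎
  where open ≡-Reasoning

_C+2C_ : ℕ → ℕ → ℕ
n C+2C k = n C k + 2 * (n C suc k)

C+2C-pascal : ∀ n k → n C+2C suc k + n C+2C k ≡ suc n C+2C suc k
C+2C-pascal n k = begin
  n C suc k + 2 * (n C suc (suc k)) + (n C k + 2 * (n C suc k))
    ≡⟨ regroup (n C k) (n C suc k) (n C suc (suc k)) ⟩
  n C k + n C suc k + 2 * (n C suc k + n C suc (suc k))
    ≡⟨ cong₂ (λ a b → a + 2 * b) (nCk+nC[k+1]≡[n+1]C[k+1] n k) (nCk+nC[k+1]≡[n+1]C[k+1] n (suc k)) ⟩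
  suc n C suc k + 2 * (suc n C suc (suc k))
    ∎
  where
  open ≡-Reasoning
  regroup : ∀ a b c → b + 2 * c + (a + 2 * b) ≡ a + b + 2 * (b + c)
  regroup = solve-∀

square≡C+2C : ∀ s → s * s ≡ s C+2C 1
square≡C+2C zero    = refl
square≡C+2C (suc s) = begin
  suc s * suc s
    ≡⟨ expand s ⟩
  suc s + s + s * s
    ≡⟨ cong (suc s + s +_) (trans (square≡C+2C s) (cong (_+ 2 * (s C 2)) (nC1≡n s))) ⟩
  suc s + s + (s + 2 * (s C 2))
    ≡⟨ regroup s (s C 2) ⟩
  suc s + 2 * (s + s C 2)
    ≡⟨ cong₂ (λ a b → a + 2 * b) (sym (nC1≡n (suc s)))
             (trans (cong (_+ s C 2) (sym (nC1≡n s))) (nCk+nC[k+1]≡[n+1]C[k+1] s 1)) ⟩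
  suc s C 1 + 2 * (suc s C 2)
    ∎
  where
  open ≡-Reasoning
  expand : ∀ s → suc s * suc s ≡ suc s + s + s * s
  expand = solve-∀
  regroup : ∀ s c → suc s + s + (s + 2 * c) ≡ suc s + 2 * (s + c)
  regroup = solve-∀

∑-hockey-C+2C : ∀ m s → ∑[ t < s ] ((m + suc (toℕ t)) C+2C suc m) ≡ (suc m + s) C+2C suc (suc m)
∑-hockey-C+2C m zero = sym $ begin
  (suc m + 0) C+2C suc (suc m)
    ≡⟨ cong (_C+2C suc (suc m)) (+-identityʳ (suc m)) ⟩
  suc m C suc (suc m) + 2 * (suc m C suc (suc (suc m)))
    ≡⟨ cong₂ (λ a b → a + 2 * b) (k>n⇒nCk≡0 (n<1+n (suc m))) (k>n⇒nCk≡0 (m<n⇒m<1+n (n<1+n (suc m)))) ⟩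
  0
    ∎
  where open ≡-Reasoning
∑-hockey-C+2C m (suc s) = begin
  ∑[ t < suc s ] ((m + suc (toℕ t)) C+2C suc m)
    ≡⟨ ∑-snoc s (λ t → (m + suc t) C+2C suc m) ⟩
  ∑[ t < s ] ((m + suc (toℕ t)) C+2C suc m) + (m + suc s) C+2C suc m
    ≡⟨ cong₂ _+_ (∑-hockey-C+2C m s) (cong (_C+2C suc m) (+-suc m s)) ⟩
  suc (m + s) C+2C suc (suc m) + suc (m + s) C+2C suc m
    ≡⟨ C+2C-pascal (suc (m + s)) (suc m) ⟩
  suc (suc (m + s)) C+2C suc (suc m)
    ≡⟨ cong (λ x → suc x C+2C suc (suc m)) (+-suc m s) ⟨
  (suc m + suc s) C+2C suc (suc m)
    ∎
  where open ≡-Reasoning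

-- Enumerations of subsets

record SubsetEnumeration (X : Set) : Set where
  field
    subsets       : List X
    _⊆ᵇ_          : X → X → Bool
    card          : X → ℕ
    sumOf-subsets : ∀ a G → sumOf (λ x → if x ⊆ᵇ a then G (card x) else 0) subsets ≡ binomialSum (card a) G

module _ (S : SubsetEnumeration X) where
  open SubsetEnumeration S

  countB-subsetsOfSize : ∀ a k → countB (λ x → (x ⊆ᵇ a) ∧ (card x ≡ᵇ k)) subsets ≡ card a C k
  countB-subsetsOfSize a k = begin
    countB (λ x → (x ⊆ᵇ a) ∧ (card x ≡ᵇ k)) subsets              ≡⟨ countB≡sumOf _ subsets ⟩
    sumOf (λ x → 𝟙 ((x ⊆ᵇ a) ∧ (card x ≡ᵇ k))) subsets           ≡⟨ sumOf-cong subsets (λ x → 𝟙-∧ (x ⊆ᵇ a) _) ⟩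
    sumOf (λ x → if x ⊆ᵇ a then 𝟙 (card x ≡ᵇ k) else 0) subsets  ≡⟨ sumOf-subsets a (λ j → 𝟙 (j ≡ᵇ k)) ⟩
    binomialSum (card a) (λ j → 𝟙 (j ≡ᵇ k))                      ≡⟨ binomialSum-≡ᵇ (card a) k ⟩
    card a C k                                                   ∎
    where open ≡-Reasoning

bits : SubsetEnumeration Bool
bits = record
  { subsets       = true ∷ false ∷ []
  ; _⊆ᵇ_          = λ x a → not x ∨ a
  ; card          = 𝟙
  ; sumOf-subsets = λ where
      true  G → trans (cong (G 1 +_) (+-identityʳ (G 0))) (+-comm (G 1) (G 0))
      false G → +-identityʳ (G 0)
  }

module _ (S : SubsetEnumeration X) where
  open SubsetEnumeration S

  _⊆ᵛ_ : ∀ {m} → (Fin m → X) → (Fin m → X) → Bool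
  _⊆ᵛ_ {zero}  f a = true
  _⊆ᵛ_ {suc m} f a = (f fz ⊆ᵇ a fz) ∧ ((f ∘ fs) ⊆ᵛ (a ∘ fs))

  cardᵛ : ∀ {m} → (Fin m → X) → ℕ
  cardᵛ {m} f = ∑[ i < m ] card (f i)

  sumOf-subsetsᵛ : ∀ m (a : Fin m → X) G →
    sumOf (λ f → if f ⊆ᵛ a then G (cardᵛ f) else 0) (allFuns m subsets) ≡ binomialSum (cardᵛ a) G
  sumOf-subsetsᵛ zero    a G = +-identityʳ (G 0)
  sumOf-subsetsᵛ (suc m) a G = begin
      sumOf (λ f → if f ⊆ᵛ a then G (cardᵛ f) else 0) (allFuns (suc m) subsets)
    ≡⟨ sumOf-allFuns-suc m subsets (λ x f → if (x ⊆ᵇ a fz) ∧ (f ⊆ᵛ a′) then G (card x + cardᵛ f) else 0) ⟩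
      sumOf (λ x → sumOf (λ f → if (x ⊆ᵇ a fz) ∧ (f ⊆ᵛ a′) then G (card x + cardᵛ f) else 0) tails) subsets
    ≡⟨ sumOf-cong subsets (λ x → sumOf-if-∧ (x ⊆ᵇ a fz) (_⊆ᵛ a′) (λ f → G (card x + cardᵛ f)) tails) ⟩
      sumOf (λ x → if x ⊆ᵇ a fz then sumOf (λ f → if f ⊆ᵛ a′ then G (card x + cardᵛ f) else 0) tails
                                  else 0) subsets
    ≡⟨ sumOf-cong subsets (λ x → cong (λ s → if x ⊆ᵇ a fz then s else 0)
                                     (sumOf-subsetsᵛ m a′ (G ∘ (card x +_)))) ⟩
      sumOf (λ x → if x ⊆ᵇ a fz then binomialSum (cardᵛ a′) (G ∘ (card x +_)) else 0) subsets
    ≡⟨ sumOf-subsets (a fz) (λ j → binomialSum (cardᵛ a′) (G ∘ (j +_))) ⟩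
      binomialSum (card (a fz)) (λ j → binomialSum (cardᵛ a′) (G ∘ (j +_)))
    ≡⟨ binomialSum-+ (card (a fz)) (cardᵛ a′) G ⟩
      binomialSum (cardᵛ a) G
    ∎
    where
    open ≡-Reasoning
    a′    = a ∘ fs
    tails = allFuns m subsets

  vectors : ∀ m → SubsetEnumeration (Fin m → X)
  vectors m = record
    { subsets = allFuns m subsets ; _⊆ᵇ_ = _⊆ᵛ_ ; card = cardᵛ ; sumOf-subsets = sumOf-subsetsᵛ m }

  ⊆ᵛ⁻ : ∀ {m} {f a : Fin m → X} → T (f ⊆ᵛ a) → ∀ i → T (f i ⊆ᵇ a i)
  ⊆ᵛ⁻ {suc m} {f} {a} t fz     = proj₁ (Equivalence.to (T-∧ {f fz ⊆ᵇ a fz}) t)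
  ⊆ᵛ⁻ {suc m} {f} {a} t (fs i) = ⊆ᵛ⁻ (proj₂ (Equivalence.to (T-∧ {f fz ⊆ᵇ a fz}) t)) i

  ⊆ᵛ⁺ : ∀ {m} {f a : Fin m → X} → (∀ i → T (f i ⊆ᵇ a i)) → T (f ⊆ᵛ a)
  ⊆ᵛ⁺ {zero}  _ = _
  ⊆ᵛ⁺ {suc m} h = Equivalence.from T-∧ (h fz , ⊆ᵛ⁺ (h ∘ fs))

-- Order polytopes of a chain below an antichain

Antichain : FinPoset → Set
Antichain Q = ∀ i j → _≺_ Q i j ≡ false

I1+I1-antichain : Antichain (I 1 +ₚ I 1)
I1+I1-antichain fz      fz      = refl
I1+I1-antichain fz      (fs fz) = refl
I1+I1-antichain (fs fz) fz      = refl
I1+I1-antichain (fs fz) (fs fz) = refl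

module _ {a n : ℕ} {i : Fin (a + n)} where
  toℕ-splitAt-inj₁ : ∀ {j} → splitAt a i ≡ inj₁ j → toℕ i ≡ toℕ j
  toℕ-splitAt-inj₁ {j} e = trans (cong toℕ (sym (splitAt⁻¹-↑ˡ e))) (toℕ-↑ˡ j n)

  toℕ-splitAt-inj₂ : ∀ {j} → splitAt a i ≡ inj₂ j → toℕ i ≡ a + toℕ j
  toℕ-splitAt-inj₂ {j} e = trans (cong toℕ (sym (splitAt⁻¹-↑ʳ e))) (toℕ-↑ʳ a j)

≺-chain⊕antichain : ∀ a Q → Antichain Q → ∀ i j → _≺_ (I a ⊕ₚ Q) i j ≡ (toℕ i <ᵇ toℕ j) ∧ (toℕ i <ᵇ a)
≺-chain⊕antichain a Q anti i j with splitAt a i in ei | splitAt a j in ej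
... | inj₁ i′ | inj₁ j′
  rewrite toℕ-splitAt-inj₁ ei | toℕ-splitAt-inj₁ ej | <ᵇ-true (toℕ<n i′) = sym (∧-identityʳ _)
... | inj₁ i′ | inj₂ j′
  rewrite toℕ-splitAt-inj₁ ei | toℕ-splitAt-inj₂ ej | <ᵇ-true (toℕ<n i′)
        | <ᵇ-true (≤-trans (toℕ<n i′) (m≤m+n a (toℕ j′))) = refl
... | inj₂ i′ | inj₁ j′
  rewrite toℕ-splitAt-inj₂ ei | <ᵇ-false (m≤m+n a (toℕ i′)) = sym (∧-zeroʳ _)
... | inj₂ i′ | inj₂ j′
  rewrite toℕ-splitAt-inj₂ ei | <ᵇ-false (m≤m+n a (toℕ i′)) = trans (anti i′ j′) (sym (∧-zeroʳ _))

module _ (P : FinPoset) (n : ℕ) (x : Fin (size P) → Fin (suc n)) where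
  inDilated⁻ : T (inDilatedOrderPolytope P n x) → ∀ i j → T (_≺_ P i j) → toℕ (x i) ≤ toℕ (x j)
  inDilated⁻ t i j i≺j = ≤ᵇ⇒≤ _ _ (T-not-∨⁻ (_≺_ P i j) (All.tabulate⁻ (allB⁻ _ _ row) j) i≺j)
    where row = All.tabulate⁻ (allB⁻ _ _ t) i

  inDilated⁺ : (∀ i j → T (_≺_ P i j) → toℕ (x i) ≤ toℕ (x j)) → T (inDilatedOrderPolytope P n x)
  inDilated⁺ mono = allB⁺ _ $ All.tabulate⁺ λ i → allB⁺ _ $ All.tabulate⁺ λ j →
    T-not-∨⁺ (_≺_ P i j) (≤⇒≤ᵇ ∘ mono i j)

module Fork (n : ℕ) where
  Point : ℕ → Set
  Point m = Fin m → Fin (suc n)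

  -- The lattice points of n·O(I m ⊕ (I 1 + I 1)) whose coordinates are all at least lo.
  forkAbove : ∀ m → ℕ → Point (m + 2) → Bool
  forkAbove zero    lo x = (lo ≤ᵇ toℕ (x fz)) ∧ (lo ≤ᵇ toℕ (x (fs fz)))
  forkAbove (suc m) lo x = (lo ≤ᵇ toℕ (x fz)) ∧ forkAbove m (toℕ (x fz)) (x ∘ fs)

  ForkOrdered : ∀ m → Point (m + 2) → Set
  ForkOrdered m x = ∀ i j → toℕ i < toℕ j → toℕ i < m → toℕ (x i) ≤ toℕ (x j)

  forkAbove⁻ : ∀ m lo x → T (forkAbove m lo x) → (∀ i → lo ≤ toℕ (x i)) × ForkOrdered m x
  forkAbove⁻ zero lo x t = bounded , λ _ _ _ ()
    where
    bounds = Equivalence.to (T-∧ {lo ≤ᵇ toℕ (x fz)}) t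
    bounded : ∀ i → lo ≤ toℕ (x i)
    bounded fz      = ≤ᵇ⇒≤ lo _ (proj₁ bounds)
    bounded (fs fz) = ≤ᵇ⇒≤ lo _ (proj₂ bounds)
  forkAbove⁻ (suc m) lo x t = bounded , ordered
    where
    parts = Equivalence.to (T-∧ {lo ≤ᵇ toℕ (x fz)}) t
    lo≤x₀ = ≤ᵇ⇒≤ lo _ (proj₁ parts)
    rest  = forkAbove⁻ m (toℕ (x fz)) (x ∘ fs) (proj₂ parts)
    bounded : ∀ i → lo ≤ toℕ (x i)
    bounded fz     = lo≤x₀
    bounded (fs i) = ≤-trans lo≤x₀ (proj₁ rest i)
    ordered : ForkOrdered (suc m) x
    ordered fz     (fs j) _         _         = proj₁ rest j
    ordered (fs i) (fs j) (s≤s i<j) (s≤s i<m) = proj₂ rest i j i<j i<m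

  forkAbove⁺ : ∀ m lo x → (∀ i → lo ≤ toℕ (x i)) → ForkOrdered m x → T (forkAbove m lo x)
  forkAbove⁺ zero    lo x bounded _       =
    Equivalence.from T-∧ (≤⇒≤ᵇ (bounded fz) , ≤⇒≤ᵇ (bounded (fs fz)))
  forkAbove⁺ (suc m) lo x bounded ordered = Equivalence.from T-∧ (≤⇒≤ᵇ (bounded fz) ,
    forkAbove⁺ m (toℕ (x fz)) (x ∘ fs) (λ i → ordered fz (fs i) z<s z<s)
                                        (λ i j i<j i<m → ordered (fs i) (fs j) (s<s i<j) (s<s i<m)))

  inDilated≡forkAbove : ∀ m x → inDilatedOrderPolytope (I m ⊕ₚ (I 1 +ₚ I 1)) n x ≡ forkAbove m 0 x
  inDilated≡forkAbove m x = T-ext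
    (λ t → forkAbove⁺ m 0 x (λ _ → z≤n) λ i j i<j i<m →
       inDilated⁻ P n x t i j (subst T (sym (≺≡ i j)) (Equivalence.from T-∧ (<⇒<ᵇ i<j , <⇒<ᵇ i<m))))
    (λ t → inDilated⁺ P n x λ i j i≺j →
       let i<j , i<m = Equivalence.to T-∧ (subst T (≺≡ i j) i≺j)
       in proj₂ (forkAbove⁻ m 0 x t) i j (<ᵇ⇒< _ _ i<j) (<ᵇ⇒< _ _ i<m))
    where
    P  = I m ⊕ₚ (I 1 +ₚ I 1)
    ≺≡ = ≺-chain⊕antichain m (I 1 +ₚ I 1) I1+I1-antichain

  values : List (Fin (suc n))
  values = allFin (suc n)

  valuesAbove : ∀ lo → sumOf (λ v → 𝟙 (lo ≤ᵇ toℕ v)) values ≡ suc n ∸ lo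
  valuesAbove lo = trans (sumOf-allFin (suc n) _) (∑-𝟙-≤ᵇ (suc n) lo)

  sumOf-forkAbove : ∀ m lo →
    sumOf (𝟙 ∘ forkAbove m lo) (allFuns (m + 2) values) ≡ (m + (suc n ∸ lo)) C+2C suc m
  sumOf-forkAbove zero lo = begin
      sumOf (𝟙 ∘ forkAbove 0 lo) (allFuns 2 values)
    ≡⟨ sumOf-allFuns-suc 1 values (λ v y → 𝟙 ((lo ≤ᵇ toℕ v) ∧ (lo ≤ᵇ toℕ (y fz)))) ⟩
      sumOf (λ v → sumOf (λ y → 𝟙 ((lo ≤ᵇ toℕ v) ∧ (lo ≤ᵇ toℕ (y fz)))) singletons) values
    ≡⟨ sumOf-cong values (λ v → sumOf-if-∧ (lo ≤ᵇ toℕ v) (λ y → lo ≤ᵇ toℕ (y fz)) (λ _ → 1) singletons) ⟩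
      sumOf (λ v → if lo ≤ᵇ toℕ v then sumOf (λ y → 𝟙 (lo ≤ᵇ toℕ (y fz))) singletons else 0) values
    ≡⟨ sumOf-if-const (λ v → lo ≤ᵇ toℕ v) _ values ⟩
      above * sumOf (λ y → 𝟙 (lo ≤ᵇ toℕ (y fz))) singletons
    ≡⟨ cong (above *_) (trans (sumOf-allFuns-suc 0 values (λ v _ → 𝟙 (lo ≤ᵇ toℕ v)))
                              (sumOf-cong values (λ v → +-identityʳ _))) ⟩
      above * above
    ≡⟨ cong₂ _*_ (valuesAbove lo) (valuesAbove lo) ⟩
      (suc n ∸ lo) * (suc n ∸ lo)
    ≡⟨ square≡C+2C (suc n ∸ lo) ⟩
      (suc n ∸ lo) C+2C 1
    ∎
    where
    open ≡-Reasoning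
    singletons = allFuns 1 values
    above      = sumOf (λ v → 𝟙 (lo ≤ᵇ toℕ v)) values
  sumOf-forkAbove (suc m) lo = begin
      sumOf (𝟙 ∘ forkAbove (suc m) lo) (allFuns (suc m + 2) values)
    ≡⟨ sumOf-allFuns-suc (m + 2) values (λ v y → 𝟙 ((lo ≤ᵇ toℕ v) ∧ forkAbove m (toℕ v) y)) ⟩
      sumOf (λ v → sumOf (λ y → 𝟙 ((lo ≤ᵇ toℕ v) ∧ forkAbove m (toℕ v) y)) tails) values
    ≡⟨ sumOf-cong values (λ v → sumOf-if-∧ (lo ≤ᵇ toℕ v) (forkAbove m (toℕ v)) (λ _ → 1) tails) ⟩
      sumOf (λ v → if lo ≤ᵇ toℕ v then sumOf (𝟙 ∘ forkAbove m (toℕ v)) tails else 0) values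
    ≡⟨ sumOf-cong values (λ v → cong (λ s → if lo ≤ᵇ toℕ v then s else 0) (sumOf-forkAbove m (toℕ v))) ⟩
      sumOf (λ v → if lo ≤ᵇ toℕ v then H (suc n ∸ toℕ v) else 0) values
    ≡⟨ sumOf-allFin (suc n) _ ⟩
      ∑[ v < suc n ] (if lo ≤ᵇ toℕ v then H (suc n ∸ toℕ v) else 0)
    ≡⟨ ∑-lowerBound (suc n) lo H ⟩
      ∑[ t < suc n ∸ lo ] H (suc (toℕ t))
    ≡⟨ ∑-hockey-C+2C m (suc n ∸ lo) ⟩
      (suc m + (suc n ∸ lo)) C+2C suc (suc m)
    ∎
    where
    open ≡-Reasoning
    tails = allFuns (m + 2) values
    H : ℕ → ℕ
    H s = (m + s) C+2C suc m

ehr-chain⊕antichain₂ : ∀ m n → ehr (I m ⊕ₚ (I 1 +ₚ I 1)) n ≡ (m + suc n) C+2C suc m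
ehr-chain⊕antichain₂ m n = begin
  ehr (I m ⊕ₚ (I 1 +ₚ I 1)) n
    ≡⟨ countB≡sumOf _ points ⟩
  sumOf (𝟙 ∘ inDilatedOrderPolytope (I m ⊕ₚ (I 1 +ₚ I 1)) n) points
    ≡⟨ sumOf-cong points (cong 𝟙 ∘ inDilated≡forkAbove m) ⟩
  sumOf (𝟙 ∘ forkAbove m 0) points
    ≡⟨ sumOf-forkAbove m 0 ⟩
  (m + suc n) C+2C suc m
    ∎
  where
  open ≡-Reasoning
  open Fork n
  points = allFuns (m + 2) values

-- Queens pairwise on common diagonals

cellSubsets : ∀ N → SubsetEnumeration (Board N)
cellSubsets N = vectors (vectors bits N) N

module Cells (N : ℕ) where
  open SubsetEnumeration (cellSubsets N) using (_⊆ᵇ_; card)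

  Queen : Board N → Cell N → Set
  Queen B x = T (occ B x)

  ⊆ᵇ⇒queens : ∀ {B A} → T (B ⊆ᵇ A) → ∀ {x} → Queen B x → Queen A x
  ⊆ᵇ⇒queens {B} t {r , c} = T-not-∨⁻ (B r c) (⊆ᵛ⁻ bits (⊆ᵛ⁻ (vectors bits N) t r) c)

  queens⇒⊆ᵇ : ∀ {B A} → (∀ {x} → Queen B x → Queen A x) → T (B ⊆ᵇ A)
  queens⇒⊆ᵇ {B} h = ⊆ᵛ⁺ (vectors bits N) λ r → ⊆ᵛ⁺ bits λ c → T-not-∨⁺ (B r c) (h {r , c})

  numQueens≡card : ∀ B → numQueens B ≡ card B
  numQueens≡card B = begin
    countB (occ B) (cells N)
      ≡⟨ countB≡sumOf (occ B) (cells N) ⟩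
    sumOf (𝟙 ∘ occ B) (cells N)
      ≡⟨ sumOf-cartesianProduct (𝟙 ∘ occ B) (allFin N) (allFin N) ⟩
    sumOf (λ r → sumOf (λ c → 𝟙 (B r c)) (allFin N)) (allFin N)
      ≡⟨ sumOf-cong (allFin N) (λ r → sumOf-allFin N (𝟙 ∘ B r)) ⟩
    sumOf (λ r → ∑[ c < N ] 𝟙 (B r c)) (allFin N)
      ≡⟨ sumOf-allFin N _ ⟩
    ∑[ r < N ] ∑[ c < N ] 𝟙 (B r c)
      ∎
    where open ≡-Reasoning

  cellIndex≡combine : ∀ (x : Cell N) → cellIndex x ≡ toℕ (combine (proj₁ x) (proj₂ x))
  cellIndex≡combine (r , c) = trans (cong (_+ toℕ c) (*-comm (toℕ r) N)) (sym (toℕ-combine r c))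

  cellIndex-injective : ∀ {x y : Cell N} → cellIndex x ≡ cellIndex y → x ≡ y
  cellIndex-injective {r , c} {r′ , c′} e = begin
    (r , c)                    ≡⟨ remQuot-combine r c ⟨
    remQuot N (combine r c)    ≡⟨ cong (remQuot N) (toℕ-injective combine≡) ⟩
    remQuot N (combine r′ c′)  ≡⟨ remQuot-combine r′ c′ ⟩
    (r′ , c′)                  ∎
    where
    open ≡-Reasoning
    combine≡ = trans (sym (cellIndex≡combine (r , c))) (trans e (cellIndex≡combine (r′ , c′)))

  cells-increasing : AllPairs (λ x y → cellIndex x < cellIndex y) (cells N)
  cells-increasing = rows-increasing (AllPairs.tabulate⁺-< (λ i<j → i<j))
    where
    rows-increasing : ∀ {rs} → AllPairs (λ i j → toℕ i < toℕ j) rs →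
                      AllPairs (λ x y → cellIndex x < cellIndex y) (cartesianProduct rs (allFin N))
    rows-increasing {[]}     []          = []
    rows-increasing {r ∷ rs} (r< ∷ rs↑) = AllPairs.++⁺
      (AllPairs.map⁺ (AllPairs.tabulate⁺-< (+-monoʳ-< (toℕ r * N))))
      (rows-increasing rs↑)
      (All.map⁺ (All.tabulate⁺ λ c → All.tabulate λ { {r′ , c′} ∈rs → subst₂ _<_
        (sym (cellIndex≡combine (r , c))) (sym (cellIndex≡combine (r′ , c′)))
        (combine-monoˡ-< c c′ (All.lookup r< (proj₁ (∈-cartesianProduct⁻ rs (allFin N) ∈rs)))) }))

  private
    pairsFrom : Cell N → Cell N → List (Cell N × Cell N)
    pairsFrom c d = if cellIndex c <ᵇ cellIndex d then [ (c , d) ] else []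

    rowPairs : Cell N → List (Cell N × Cell N)
    rowPairs c = concatMap (pairsFrom c) (cells N)

    ∈-pairsFrom : ∀ {c d pr} → pr ∈ pairsFrom c d → pr ≡ (c , d) × cellIndex c < cellIndex d
    ∈-pairsFrom {c} {d} m with cellIndex c <ᵇ cellIndex d in lt | m
    ... | true | here refl = refl , <ᵇ⇒< _ _ (subst T (sym lt) _)

    ∈-cells : ∀ (x : Cell N) → x ∈ cells N
    ∈-cells (r , c) = ∈-cartesianProduct⁺ (∈-allFin r) (∈-allFin c)

  ∈-cellPairs⁻ : ∀ {c d} → (c , d) ∈ cellPairs N → cellIndex c < cellIndex d
  ∈-cellPairs⁻ ∈ps
    with c′ , ∈row  ← Any.satisfied (∈-concatMap⁻ rowPairs {cells N} ∈ps)
    with _  , ∈pair ← Any.satisfied (∈-concatMap⁻ (pairsFrom c′) {cells N} ∈row)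
    with refl , lt  ← ∈-pairsFrom ∈pair
    = lt

  ∈-cellPairs⁺ : ∀ {c d} → cellIndex c < cellIndex d → (c , d) ∈ cellPairs N
  ∈-cellPairs⁺ {c} {d} lt =
    ∈-concatMap⁺ rowPairs {cells N} (Any.map (λ { refl → ∈row }) (∈-cells c))
    where
    ∈pair : (c , d) ∈ pairsFrom c d
    ∈pair rewrite <ᵇ-true lt = here refl
    ∈row : (c , d) ∈ rowPairs c
    ∈row = ∈-concatMap⁺ (pairsFrom c) {cells N} (Any.map (λ { refl → ∈pair }) (∈-cells d))

  All-cellPairs⁺ : ∀ {P : Cell N × Cell N → Set} →
                   (∀ c d → cellIndex c < cellIndex d → P (c , d)) → All P (cellPairs N)
  All-cellPairs⁺ h = All.tabulate λ { {c , d} ∈ps → h c d (∈-cellPairs⁻ ∈ps) }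

  All-cellPairs⁻ : ∀ {P : Cell N × Cell N → Set} →
                   All P (cellPairs N) → ∀ c d → cellIndex c < cellIndex d → P (c , d)
  All-cellPairs⁻ a c d lt = All.lookup a (∈-cellPairs⁺ lt)

  sumOf-cellPairs : ∀ f → sumOf f (cellPairs N) ≡
    sumOf (λ c → sumOf (λ d → if cellIndex c <ᵇ cellIndex d then f (c , d) else 0) (cells N)) (cells N)
  sumOf-cellPairs f = trans (sumOf-concatMap f rowPairs (cells N)) $ sumOf-cong (cells N) λ c →
    trans (sumOf-concatMap f (pairsFrom c) (cells N)) (sumOf-cong (cells N) (sumOf-pairsFrom c))
    where
    sumOf-pairsFrom : ∀ c d → sumOf f (pairsFrom c d) ≡ (if cellIndex c <ᵇ cellIndex d then f (c , d) else 0)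
    sumOf-pairsFrom c d with cellIndex c <ᵇ cellIndex d
    ... | true  = +-identityʳ (f (c , d))
    ... | false = refl

  occupiedPairs : Board N → ℕ
  occupiedPairs B = countB (λ pr → occ B (proj₁ pr) ∧ occ B (proj₂ pr)) (cellPairs N)

  occupiedPairs≡ : ∀ B → occupiedPairs B ≡ numQueens B C 2
  occupiedPairs≡ B = begin
      occupiedPairs B
    ≡⟨ countB≡sumOf _ (cellPairs N) ⟩
      sumOf (λ pr → 𝟙 (occ B (proj₁ pr) ∧ occ B (proj₂ pr))) (cellPairs N)
    ≡⟨ sumOf-cellPairs _ ⟩
      sumOf (λ c → sumOf (λ d → if cellIndex c <ᵇ cellIndex d then 𝟙 (occ B c ∧ occ B d) else 0)
                         (cells N)) (cells N)
    ≡⟨ sumOf-increasingPairs (occ B) cellIndex cells-increasing ⟩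
      numQueens B C 2
    ∎
    where open ≡-Reasoning

  row col : Cell N → ℕ
  row = toℕ ∘ proj₁
  col = toℕ ∘ proj₂

  OnCommonDiagonal : Cell N → Cell N → Set
  OnCommonDiagonal x y = row x + col y ≡ row y + col x ⊎ row x + col x ≡ row y + col y

  onCommonDiagonal-sym : ∀ {x y} → OnCommonDiagonal x y → OnCommonDiagonal y x
  onCommonDiagonal-sym = ⊎-map sym sym

  T-sameDiag⁻ : ∀ {x y} → T (sameDiag x y) → OnCommonDiagonal x y
  T-sameDiag⁻ {r₁ , c₁} {r₂ , c₂} t = ⊎-map (≡ᵇ⇒≡ (toℕ r₁ + toℕ c₂) _) (≡ᵇ⇒≡ (toℕ r₁ + toℕ c₁) _)
    (Equivalence.to (T-∨ {toℕ r₁ + toℕ c₂ ≡ᵇ toℕ r₂ + toℕ c₁}) t)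

  T-sameDiag⁺ : ∀ {x y} → OnCommonDiagonal x y → T (sameDiag x y)
  T-sameDiag⁺ {r₁ , c₁} {r₂ , c₂} d = Equivalence.from (T-∨ {toℕ r₁ + toℕ c₂ ≡ᵇ toℕ r₂ + toℕ c₁})
    (⊎-map (≡⇒≡ᵇ (toℕ r₁ + toℕ c₂) _) (≡⇒≡ᵇ (toℕ r₁ + toℕ c₁) _) d)

  allAttacking : ℕ → Board N → Bool
  allAttacking k B = (numQueens B ≡ᵇ k) ∧ nonAttackingRowsCols B ∧ (diagonalPairs B ≡ᵇ (k C 2))

  allAttacking⁻ : ∀ {k B} → T (allAttacking k B) →
    numQueens B ≡ k × (∀ {x y} → Queen B x → Queen B y → x ≢ y → OnCommonDiagonal x y)
  allAttacking⁻ {k} {B} t = queens≡k , pairwise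
    where
    parts    = Equivalence.to (T-∧ {numQueens B ≡ᵇ k}) t
    queens≡k = ≡ᵇ⇒≡ _ _ (proj₁ parts)
    diagonal≡occupied : diagonalPairs B ≡ occupiedPairs B
    diagonal≡occupied = begin
      diagonalPairs B  ≡⟨ ≡ᵇ⇒≡ _ _ (proj₂ (Equivalence.to (T-∧ {nonAttackingRowsCols B}) (proj₂ parts))) ⟩
      k C 2            ≡⟨ cong (_C 2) queens≡k ⟨
      numQueens B C 2  ≡⟨ occupiedPairs≡ B ⟨
      occupiedPairs B  ∎
      where open ≡-Reasoning
    occupied = λ (pr : Cell N × Cell N) → occ B (proj₁ pr) ∧ occ B (proj₂ pr)
    allDiagonal = countB-≡⇒All occupied _
      (λ { (c , d) t → let qc , rest = Equivalence.to (T-∧ {occ B c}) t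
                       in Equivalence.from T-∧ (qc , proj₁ (Equivalence.to (T-∧ {occ B d}) rest)) })
      (cellPairs N) diagonal≡occupied
    increasing : ∀ {x y} → cellIndex x < cellIndex y → Queen B x → Queen B y → OnCommonDiagonal x y
    increasing {x} {y} lt qx qy = T-sameDiag⁻ {x} {y} $
      proj₂ (Equivalence.to (T-∧ {occ B y}) (proj₂ (Equivalence.to (T-∧ {occ B x})
        (All-cellPairs⁻ allDiagonal x y lt (Equivalence.from T-∧ (qx , qy))))))
    pairwise : ∀ {x y} → Queen B x → Queen B y → x ≢ y → OnCommonDiagonal x y
    pairwise {x} {y} qx qy x≢y with <-cmp (cellIndex x) (cellIndex y)
    ... | tri< lt _ _ = increasing lt qx qy
    ... | tri≈ _ eq _ = contradiction (cellIndex-injective eq) x≢y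
    ... | tri> _ _ gt = onCommonDiagonal-sym {y} {x} (increasing gt qy qx)

module _ {P B : Set} (_≟_ : DecidableEquality P) {f g : P → B}
         (transversal : ∀ {x y} → f x ≡ f y → g x ≡ g y → x ≡ y) where
  sharedLine : (S : P → Set) → (∀ {x y} → S x → S y → x ≢ y → f x ≡ f y ⊎ g x ≡ g y) →
               ∀ {p q} → S p → S q → p ≢ q → f p ≡ f q → ∀ {x} → S x → f x ≡ f p
  sharedLine S pairwise {p} {q} Sp Sq p≢q fp≡fq {x} Sx with x ≟ p
  ... | yes refl = refl
  ... | no x≢p with pairwise Sx Sp x≢p
  ...   | inj₁ fx≡fp = fx≡fp
  ...   | inj₂ gx≡gp with x ≟ q
  ...     | yes refl = contradiction (transversal fp≡fq (sym gx≡gp)) p≢q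
  ...     | no x≢q with pairwise Sx Sq x≢q
  ...       | inj₁ fx≡fq = trans fx≡fq (sym fp≡fq)
  ...       | inj₂ gx≡gq = contradiction (transversal fp≡fq (trans (sym gx≡gp) gx≡gq)) p≢q

module Lines (N′ : ℕ) where
  N : ℕ
  N = suc N′

  open Cells N
  open SubsetEnumeration (cellSubsets N) using (_⊆ᵇ_; card)

  cell-≡ : ∀ {x y : Cell N} → row x ≡ row y → col x ≡ col y → x ≡ y
  cell-≡ e₁ e₂ = cong₂ _,_ (toℕ-injective e₁) (toℕ-injective e₂)

  -- Reflecting the rows (r ↦ N′ ∸ r) turns diagonals into antidiagonals.
  diagonalIndex antidiagonalIndex : Cell N → ℕ
  diagonalIndex     x = toℕ (opposite (proj₁ x)) + col x
  antidiagonalIndex x = row x + col x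

  opposite+toℕ : ∀ (r : Fin N) → toℕ (opposite r) + toℕ r ≡ N′
  opposite+toℕ r = trans (cong (_+ toℕ r) (opposite-prop r)) (m∸n+n≡m (≤-pred (toℕ<n r)))

  diagonalIndex-balance : ∀ x y → diagonalIndex x + (row x + col y) ≡ diagonalIndex y + (row y + col x)
  diagonalIndex-balance x y = begin
    (o x + col x) + (row x + col y)
      ≡⟨ regroup (o x) (col x) (row x) (col y) ⟩
    (o x + row x) + (col x + col y)
      ≡⟨ cong (_+ (col x + col y)) (trans (opposite+toℕ (proj₁ x)) (sym (opposite+toℕ (proj₁ y)))) ⟩
    (o y + row y) + (col x + col y)
      ≡⟨ regroup′ (o y) (row y) (col x) (col y) ⟩
    (o y + col y) + (row y + col x)
      ∎
    where
    open ≡-Reasoning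
    o : Cell N → ℕ
    o = toℕ ∘ opposite ∘ proj₁
    regroup : ∀ a b c d → a + b + (c + d) ≡ a + c + (b + d)
    regroup = solve-∀
    regroup′ : ∀ a b c d → a + b + (c + d) ≡ a + d + (b + c)
    regroup′ = solve-∀

  diagonalIndex⇒ : ∀ {x y} → diagonalIndex x ≡ diagonalIndex y → row x + col y ≡ row y + col x
  diagonalIndex⇒ {x} {y} e = +-cancelˡ-≡ (diagonalIndex y) (row x + col y) (row y + col x)
    (trans (cong (_+ (row x + col y)) (sym e)) (diagonalIndex-balance x y))

  diagonalIndex⇐ : ∀ {x y} → row x + col y ≡ row y + col x → diagonalIndex x ≡ diagonalIndex y
  diagonalIndex⇐ {x} {y} e = +-cancelʳ-≡ (row x + col y) (diagonalIndex x) (diagonalIndex y)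
    (trans (diagonalIndex-balance x y) (cong (diagonalIndex y +_) (sym e)))

  diagonal∩antidiagonal : ∀ {x y} → diagonalIndex x ≡ diagonalIndex y →
                          antidiagonalIndex x ≡ antidiagonalIndex y → x ≡ y
  diagonal∩antidiagonal {x} {y} d a =
    cell-≡ rows (+-cancelˡ-≡ (row x) (col x) (col y) (trans a (cong (_+ col y) (sym rows))))
    where
    open ≡-Reasoning
    double : ∀ r c c′ → 2 * r + (c + c′) ≡ (r + c′) + (r + c)
    double = solve-∀
    rows : row x ≡ row y
    rows = *-cancelˡ-≡ (row x) (row y) 2 $ +-cancelʳ-≡ (col x + col y) (2 * row x) (2 * row y) $ begin
      2 * row x + (col x + col y)        ≡⟨ double (row x) (col x) (col y) ⟩
      (row x + col y) + (row x + col x)  ≡⟨ cong₂ _+_ (diagonalIndex⇒ {x} {y} d) a ⟩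
      (row y + col x) + (row y + col y)  ≡⟨ double (row y) (col y) (col x) ⟨
      2 * row y + (col y + col x)        ≡⟨ cong (2 * row y +_) (+-comm (col y) (col x)) ⟩
      2 * row y + (col x + col y)        ∎

  record LineFamily : Set where
    field
      index          : Cell N → ℕ
      index<         : ∀ x → index x < N + N′
      index⇒diagonal : ∀ {x y} → index x ≡ index y → OnCommonDiagonal x y
      sameRow⇒≡      : ∀ {x y} → index x ≡ index y → row x ≡ row y → x ≡ y
      sameCol⇒≡      : ∀ {x y} → index x ≡ index y → col x ≡ col y → x ≡ y
  open LineFamily

  index-bound : ∀ (i j : Fin N) → toℕ i + toℕ j < N + N′
  index-bound i j = s≤s (+-mono-≤ (≤-pred (toℕ<n i)) (≤-pred (toℕ<n j)))

  diagonals : LineFamily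
  diagonals = record
    { index          = diagonalIndex
    ; index<         = λ x → index-bound (opposite (proj₁ x)) (proj₂ x)
    ; index⇒diagonal = λ {x} {y} → inj₁ ∘ diagonalIndex⇒ {x} {y}
    ; sameRow⇒≡      = λ {x} {y} e rows → cell-≡ rows (sym (+-cancelˡ-≡ (row x) (col y) (col x)
                          (trans (diagonalIndex⇒ {x} {y} e) (cong (_+ col x) (sym rows)))))
    ; sameCol⇒≡      = λ {x} {y} e cols → cell-≡ (+-cancelʳ-≡ (col y) (row x) (row y)
                          (trans (diagonalIndex⇒ {x} {y} e) (cong (row y +_) cols))) cols
    }

  antidiagonals : LineFamily
  antidiagonals = record
    { index          = antidiagonalIndex
    ; index<         = λ x → index-bound (proj₁ x) (proj₂ x)
    ; index⇒diagonal = inj₂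
    ; sameRow⇒≡      = λ {x} {y} e rows → cell-≡ rows (+-cancelˡ-≡ (row x) (col x) (col y)
                          (trans e (cong (_+ col y) (sym rows))))
    ; sameCol⇒≡      = λ {x} {y} e cols → cell-≡ (+-cancelʳ-≡ (col x) (row x) (row y)
                          (trans e (cong (row y +_) (sym cols)))) cols
    }

  onCommonDiagonal⇒index : ∀ {x y} → OnCommonDiagonal x y →
    index diagonals x ≡ index diagonals y ⊎ index antidiagonals x ≡ index antidiagonals y
  onCommonDiagonal⇒index {x} {y} = ⊎-map (diagonalIndex⇐ {x} {y}) (λ e → e)

  module _ (L : LineFamily) where
    line : ℕ → Board N
    line t r c = index L (r , c) ≡ᵇ t

    ⊆-line⁻ : ∀ {B t} → T (B ⊆ᵇ line t) → ∀ {x} → Queen B x → index L x ≡ t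
    ⊆-line⁻ {B} {t} sub {r , c} q = ≡ᵇ⇒≡ (index L (r , c)) t (⊆ᵇ⇒queens {B} {line t} sub q)

    ⊆-line⁺ : ∀ {B t} → (∀ {x} → Queen B x → index L x ≡ t) → T (B ⊆ᵇ line t)
    ⊆-line⁺ {B} {t} h = queens⇒⊆ᵇ {B} {line t} λ { {r , c} q → ≡⇒≡ᵇ (index L (r , c)) t (h q) }

    onLine⇒allAttacking : ∀ {B t k} → T (B ⊆ᵇ line t) → card B ≡ k → T (allAttacking k B)
    onLine⇒allAttacking {B} {t} {k} sub card≡k = Equivalence.from T-∧
      (≡⇒≡ᵇ (numQueens B) k queens≡k , Equivalence.from T-∧ (nonAttacking , ≡⇒≡ᵇ _ (k C 2) pairs≡))
      where
      open ≡-Reasoning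
      queens≡k = trans (numQueens≡card B) card≡k
      sameLine : ∀ {x y} → Queen B x → Queen B y → index L x ≡ index L y
      sameLine qx qy = trans (⊆-line⁻ {B} sub qx) (sym (⊆-line⁻ {B} sub qy))
      distinct : ∀ {x y : Cell N} → cellIndex x < cellIndex y → x ≢ y
      distinct lt refl = <-irrefl refl lt
      nonAttacking : T (nonAttackingRowsCols B)
      nonAttacking = allB⁺ _ $ All-cellPairs⁺ λ { (r₁ , c₁) (r₂ , c₂) lt →
        T-not-∨⁺ (occ B (r₁ , c₁) ∧ occ B (r₂ , c₂)) λ both →
          let q₁ , q₂ = Equivalence.to (T-∧ {B r₁ c₁}) both
              same    = sameLine {r₁ , c₁} {r₂ , c₂} q₁ q₂
          in Equivalence.from T-∧
               ( T-not (distinct lt ∘ sameRow⇒≡ L same ∘ ≡ᵇ⇒≡ (toℕ r₁) (toℕ r₂))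
               , T-not (distinct lt ∘ sameCol⇒≡ L same ∘ ≡ᵇ⇒≡ (toℕ c₁) (toℕ c₂))) }
      diagonalIfOccupied : ∀ c d → (occ B c ∧ occ B d ∧ sameDiag c d) ≡ (occ B c ∧ occ B d)
      diagonalIfOccupied c d with occ B c in qc | occ B d in qd
      ... | true  | true  = Equivalence.to T-≡ $ T-sameDiag⁺ {c} {d} $
                              index⇒diagonal L (sameLine (subst T (sym qc) _) (subst T (sym qd) _))
      ... | true  | false = refl
      ... | false | _     = refl
      pairs≡ : diagonalPairs B ≡ k C 2
      pairs≡ = begin
        diagonalPairs B  ≡⟨ countB-congᴬ (All-cellPairs⁺ λ c d _ → diagonalIfOccupied c d) ⟩
        occupiedPairs B  ≡⟨ occupiedPairs≡ B ⟩
        numQueens B C 2  ≡⟨ cong (_C 2) queens≡k ⟩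
        k C 2            ∎

    onLine : ℕ → Board N → ℕ → Bool
    onLine k B t = (B ⊆ᵇ line t) ∧ (card B ≡ᵇ k)

    linesThrough : ℕ → Board N → ℕ
    linesThrough k B = ∑[ t < N + N′ ] 𝟙 (onLine k B (toℕ t))

    linesThrough-invalid : ∀ {k B} → ¬ T (allAttacking k B) → linesThrough k B ≡ 0
    linesThrough-invalid {k} {B} invalid = trans (∑-cong (N + N′) λ t → 𝟙-¬T λ on →
      let sub , card≡k = Equivalence.to (T-∧ {B ⊆ᵇ line (toℕ t)} {card B ≡ᵇ k}) on
      in invalid (onLine⇒allAttacking {B} {toℕ t} sub (≡ᵇ⇒≡ (card B) k card≡k)))
      (sum-replicate-zero (N + N′))

    linesThrough-collinear : ∀ {k B q} → card B ≡ k → Queen B q →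
                             (∀ {x} → Queen B x → index L x ≡ index L q) → linesThrough k B ≡ 1
    linesThrough-collinear {k} {B} {q} card≡k qq collinear = begin
      linesThrough k B                        ≡⟨ ∑-cong (N + N′) (cong 𝟙 ∘ onLine≡) ⟩
      ∑[ t < N + N′ ] 𝟙 (toℕ t ≡ᵇ index L q)  ≡⟨ ∑-𝟙-≡ᵇ (N + N′) (index L q) ⟩
      𝟙 (index L q <ᵇ N + N′)                 ≡⟨ cong 𝟙 (<ᵇ-true (index< L q)) ⟩
      1                                       ∎
      where
      open ≡-Reasoning
      onLine≡ : ∀ t → onLine k B (toℕ t) ≡ (toℕ t ≡ᵇ index L q)
      onLine≡ t = T-ext
        (λ on → let sub = proj₁ (Equivalence.to (T-∧ {B ⊆ᵇ line (toℕ t)} {card B ≡ᵇ k}) on)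
                in ≡⇒≡ᵇ (toℕ t) (index L q) (sym (⊆-line⁻ {B} sub qq)))
        (λ t≡q → Equivalence.from T-∧
          ( ⊆-line⁺ {B} (λ qx → trans (collinear qx) (sym (≡ᵇ⇒≡ (toℕ t) (index L q) t≡q)))
          , ≡⇒≡ᵇ (card B) k card≡k))

    linesThrough-noncollinear : ∀ {k B q₁ q₂} → Queen B q₁ → Queen B q₂ → index L q₁ ≢ index L q₂ →
                                linesThrough k B ≡ 0
    linesThrough-noncollinear {k} {B} q₁ q₂ apart = trans (∑-cong (N + N′) λ t → 𝟙-¬T λ on →
      let sub = proj₁ (Equivalence.to (T-∧ {B ⊆ᵇ line (toℕ t)} {card B ≡ᵇ k}) on)
      in apart (trans (⊆-line⁻ {B} sub q₁) (sym (⊆-line⁻ {B} sub q₂))))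
      (sum-replicate-zero (N + N′))

    sumOf-linesThrough : ∀ k → sumOf (linesThrough k) (allBoards N) ≡ ∑[ t < N + N′ ] (card (line (toℕ t)) C k)
    sumOf-linesThrough k =
      trans (sumOf-∑ {n = N + N′} (λ B t → 𝟙 (onLine k B (toℕ t))) (allBoards N)) $ ∑-cong (N + N′) λ t →
        trans (sym (countB≡sumOf (λ B → onLine k B (toℕ t)) (allBoards N)))
              (countB-subsetsOfSize (cellSubsets N) (line (toℕ t)) k)

  _≟ᶜ_ : DecidableEquality (Cell N)
  _≟ᶜ_ = ≡-dec Fin._≟_ Fin._≟_

  module _ (L L′ : LineFamily)
           (transversal : ∀ {x y} → index L x ≡ index L y → index L′ x ≡ index L′ y → x ≡ y) where
    collinear-along : ∀ {k B q₁ q₂} → card B ≡ k →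
      (∀ {x y} → Queen B x → Queen B y → x ≢ y → index L x ≡ index L y ⊎ index L′ x ≡ index L′ y) →
      Queen B q₁ → Queen B q₂ → q₁ ≢ q₂ → index L q₁ ≡ index L q₂ →
      linesThrough L k B ≡ 1 × linesThrough L′ k B ≡ 0
    collinear-along {B = B} card≡k pairwise Bq₁ Bq₂ q₁≢q₂ same =
      linesThrough-collinear L card≡k Bq₁ (sharedLine _≟ᶜ_ transversal (Queen B) pairwise Bq₁ Bq₂ q₁≢q₂ same) ,
      linesThrough-noncollinear L′ Bq₁ Bq₂ (q₁≢q₂ ∘ transversal same)

  onOneLine : ∀ {k B q₁ q₂} → card B ≡ k →
    (∀ {x y} → Queen B x → Queen B y → x ≢ y →
       index diagonals x ≡ index diagonals y ⊎ index antidiagonals x ≡ index antidiagonals y) →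
    Queen B q₁ → Queen B q₂ → q₁ ≢ q₂ → linesThrough diagonals k B + linesThrough antidiagonals k B ≡ 1
  onOneLine card≡k pairwise Bq₁ Bq₂ q₁≢q₂ with pairwise Bq₁ Bq₂ q₁≢q₂
  ... | inj₁ same =
    let one , none = collinear-along diagonals antidiagonals diagonal∩antidiagonal
                                     card≡k pairwise Bq₁ Bq₂ q₁≢q₂ same
    in cong₂ _+_ one none
  ... | inj₂ same =
    let one , none = collinear-along antidiagonals diagonals (λ {x} {y} a d → diagonal∩antidiagonal {x} {y} d a)
                                     card≡k (λ {x} {y} qx qy → Sum.swap ∘ pairwise {x} {y} qx qy)
                                     Bq₁ Bq₂ q₁≢q₂ same
    in cong₂ _+_ none one

  classification : ∀ {k} → 2 ≤ k → ∀ B →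
                   𝟙 (allAttacking k B) ≡ linesThrough diagonals k B + linesThrough antidiagonals k B
  classification {k} 2≤k B with allAttacking k B in valid
  ... | false = sym (cong₂ _+_ (linesThrough-invalid diagonals {k} {B} (subst T valid))
                               (linesThrough-invalid antidiagonals {k} {B} (subst T valid)))
  ... | true =
    let queens≡k , pairwise = allAttacking⁻ {k} {B} (subst T (sym valid) _)
        q₁ , q₂ , Bq₁ , Bq₂ , q₁<q₂ = pickTwo (occ B) cells-increasing (subst (2 ≤_) (sym queens≡k) 2≤k)
    in sym (onOneLine (trans (sym (numQueens≡card B)) queens≡k)
                      (λ {x} {y} qx qy → onCommonDiagonal⇒index {x} {y} ∘ pairwise qx qy)
                      Bq₁ Bq₂ (λ q₁≡q₂ → <-irrefl (cong cellIndex q₁≡q₂) q₁<q₂))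

  antidiagonal-length : ∀ t → t < N → card (line antidiagonals t) ≡ suc t
  antidiagonal-length t t<N = begin
    ∑[ r < N ] ∑[ c < N ] 𝟙 (toℕ r + toℕ c ≡ᵇ t)    ≡⟨ ∑-cong N (λ r → ∑-𝟙-+≡ᵇ (toℕ r) N t) ⟩
    ∑[ r < N ] 𝟙 ((toℕ r ≤ᵇ t) ∧ (t <ᵇ toℕ r + N))  ≡⟨ ∑-cong N (λ r → cong 𝟙 (below (toℕ r))) ⟩
    ∑[ r < N ] 𝟙 (toℕ r <ᵇ suc t)                  ≡⟨ ∑-𝟙-<ᵇ N (suc t) t<N ⟩
    suc t                                          ∎
    where
    open ≡-Reasoning
    below : ∀ r → ((r ≤ᵇ t) ∧ (t <ᵇ r + N)) ≡ (r <ᵇ suc t)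
    below r = begin
      (r ≤ᵇ t) ∧ (t <ᵇ r + N)  ≡⟨ cong ((r ≤ᵇ t) ∧_) (<ᵇ-true (≤-trans t<N (m≤n+m N r))) ⟩
      (r ≤ᵇ t) ∧ true          ≡⟨ ∧-identityʳ (r ≤ᵇ t) ⟩
      r ≤ᵇ t                   ≡⟨ ≤ᵇ≡<ᵇsuc r t ⟩
      r <ᵇ suc t               ∎

  antidiagonal-length′ : ∀ u → card (line antidiagonals (N + u)) ≡ N′ ∸ u
  antidiagonal-length′ u = begin
    ∑[ r < N ] ∑[ c < N ] 𝟙 (toℕ r + toℕ c ≡ᵇ N + u)        ≡⟨ ∑-cong N (λ r → ∑-𝟙-+≡ᵇ (toℕ r) N (N + u)) ⟩
    ∑[ r < N ] 𝟙 ((toℕ r ≤ᵇ N + u) ∧ (N + u <ᵇ toℕ r + N))  ≡⟨ ∑-cong N (λ r → cong 𝟙 (above r)) ⟩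
    ∑[ r < N ] 𝟙 (suc u ≤ᵇ toℕ r)                          ≡⟨ ∑-𝟙-≤ᵇ N (suc u) ⟩
    N′ ∸ u                                                 ∎
    where
    open ≡-Reasoning
    above : ∀ r → ((toℕ r ≤ᵇ N + u) ∧ (N + u <ᵇ toℕ r + N)) ≡ (suc u ≤ᵇ toℕ r)
    above r = cong₂ _∧_ (Equivalence.to T-≡ (≤⇒≤ᵇ (≤-trans (<⇒≤ (toℕ<n r)) (m≤m+n N u))))
                        (trans (cong (N + u <ᵇ_) (+-comm (toℕ r) N)) (+-<ᵇ-cancelˡ N u (toℕ r)))

  diagonal-length : ∀ t → card (line diagonals t) ≡ card (line antidiagonals t)
  diagonal-length t = sym (∑-permute {N} {N} (λ r → ∑[ c < N ] 𝟙 (toℕ r + toℕ c ≡ᵇ t)) reversal)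

  ∑-lineLengths : ∀ k → ∑[ t < N + N′ ] (card (line antidiagonals (toℕ t)) C suc k) ≡ N C+2C suc k
  ∑-lineLengths k = begin
    ∑[ t < N + N′ ] (card (line antidiagonals (toℕ t)) C suc k)
      ≡⟨ ∑-split N N′ (λ t → card (line antidiagonals t) C suc k) ⟩
    ∑[ t < N ] (card (line antidiagonals (toℕ t)) C suc k)
      + ∑[ u < N′ ] (card (line antidiagonals (N + toℕ u)) C suc k)
      ≡⟨ cong₂ _+_ (∑-cong N λ t → cong (_C suc k) (antidiagonal-length (toℕ t) (toℕ<n t)))
                   (∑-cong N′ λ u → cong (_C suc k) (antidiagonal-length′ (toℕ u))) ⟩
    ∑[ t < N ] (suc (toℕ t) C suc k) + ∑[ u < N′ ] ((N′ ∸ toℕ u) C suc k)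
      ≡⟨ cong (∑[ t < N ] (suc (toℕ t) C suc k) +_) (∑-reverse N′ (_C suc k)) ⟩
    ∑[ t < N ] (suc (toℕ t) C suc k) + ∑[ u < N′ ] (suc (toℕ u) C suc k)
      ≡⟨ cong₂ _+_ (∑-hockey N k) (∑-hockey N′ k) ⟩
    suc N C suc (suc k) + N C suc (suc k)
      ≡⟨ cong (_+ N C suc (suc k)) (nCk+nC[k+1]≡[n+1]C[k+1] N (suc k)) ⟨
    N C suc k + N C suc (suc k) + N C suc (suc k)
      ≡⟨ twice (N C suc k) (N C suc (suc k)) ⟩
    N C+2C suc k
      ∎
    where
    open ≡-Reasoning
    twice : ∀ a b → a + b + b ≡ a + 2 * b
    twice = solve-∀

  placementsAlong : ∀ L k → (∀ t → card (line L t) ≡ card (line antidiagonals t)) →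
                    sumOf (linesThrough L (suc k)) (allBoards N) ≡ N C+2C suc k
  placementsAlong L k lengths = begin
    sumOf (linesThrough L (suc k)) (allBoards N)
      ≡⟨ sumOf-linesThrough L (suc k) ⟩
    ∑[ t < N + N′ ] (card (line L (toℕ t)) C suc k)
      ≡⟨ ∑-cong (N + N′) (cong (_C suc k) ∘ lengths ∘ toℕ) ⟩
    ∑[ t < N + N′ ] (card (line antidiagonals (toℕ t)) C suc k)
      ≡⟨ ∑-lineLengths k ⟩
    N C+2C suc k
      ∎
    where open ≡-Reasoning

  queenPlacements≡ : ∀ k → 2 ≤ k → queenPlacements N k (k C 2) ≡ 2 * (N C+2C k)
  queenPlacements≡ k@(suc k′) 2≤k = begin
    countB (allAttacking k) (allBoards N)
      ≡⟨ countB≡sumOf (allAttacking k) (allBoards N) ⟩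
    sumOf (𝟙 ∘ allAttacking k) (allBoards N)
      ≡⟨ sumOf-cong (allBoards N) (classification 2≤k) ⟩
    sumOf (λ B → linesThrough diagonals k B + linesThrough antidiagonals k B) (allBoards N)
      ≡⟨ sumOf-+ (linesThrough diagonals k) (linesThrough antidiagonals k) (allBoards N) ⟩
    sumOf (linesThrough diagonals k) (allBoards N) + sumOf (linesThrough antidiagonals k) (allBoards N)
      ≡⟨ cong₂ _+_ (placementsAlong diagonals k′ diagonal-length) (placementsAlong antidiagonals k′ (λ _ → refl)) ⟩
    N C+2C k + N C+2C k
      ≡⟨ cong (N C+2C k +_) (+-identityʳ (N C+2C k)) ⟨
    2 * (N C+2C k)
      ∎
    where open ≡-Reasoning

queenPlacements-allAttacking : ∀ N k → 1 ≤ N → 2 ≤ k → queenPlacements N k (k C 2) ≡ 2 * (N C+2C k)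
queenPlacements-allAttacking (suc N′) k _ = Lines.queenPlacements≡ N′ k

proposition4p7 : (ℓ n : ℕ) → 1 ≤ n →
    2 * ehr (I (ℓ + 1) ⊕ₚ (I 1 +ₚ I 1)) n
      ≡ queenPlacements (n + ℓ + 2) (ℓ + 2) ((ℓ + 2) C 2)
-- The identity holds for n = 0 as well.
proposition4p7 ℓ n _ = begin
  2 * ehr (I (ℓ + 1) ⊕ₚ (I 1 +ₚ I 1)) n
    ≡⟨ cong (2 *_) (ehr-chain⊕antichain₂ (ℓ + 1) n) ⟩
  2 * ((ℓ + 1 + suc n) C+2C suc (ℓ + 1))
    ≡⟨ cong₂ (λ N k → 2 * (N C+2C k)) (boardSize ℓ n) (queens ℓ) ⟩
  2 * ((n + ℓ + 2) C+2C (ℓ + 2))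
    ≡⟨ queenPlacements-allAttacking (n + ℓ + 2) (ℓ + 2) (≤-trans (s≤s z≤n) (m≤n+m 2 (n + ℓ))) (m≤n+m 2 ℓ) ⟨
  queenPlacements (n + ℓ + 2) (ℓ + 2) ((ℓ + 2) C 2)
    ∎
  where
  open ≡-Reasoning
  boardSize : ∀ ℓ n → ℓ + 1 + suc n ≡ n + ℓ + 2
  boardSize = solve-∀
  queens : ∀ ℓ → suc (ℓ + 1) ≡ ℓ + 2
  queens = solve-∀
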